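{- Let $G$ be a cubic graph and $\omega$ an end of $G$. Then the maximum number of pairwise edge-disjoint rays belonging to $\omega$ equals the maximum number of pairwise vertex-disjoint rays belonging to $\omega$.
   Context: A cubic graph is a (simple, possibly infinite) graph in which every vertex has degree $3$. A ray is a one-way infinite path; an end is an equivalence class of rays, where two rays are equivalent if no finite vertex set separates them. The (edge-)degree of an end is the maximum number of edge-disjoint rays in it, and its vertex-degree is the maximum number of vertex-disjoint rays in it. -}

module Defs where

open import Data.Nat using (ℕ; suc)
open import Data.Fin using (Fin)
open import Data.Product using (Σ; _×_)
open import Data.Sum using (_⊎_)
open import Data.List using (List; []; _∷_)
open import Data.List.Relation.Unary.Any using (Any)
open import Data.List.Membership.Propositional using (_∈_)
open import Relation.Binary.PropositionalEquality using (_≡_; _≢_)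
open import Relation.Nullary using (¬_)
open import Function.Bundles using (_↔_)

-- A simple graph on an arbitrary (possibly infinite) vertex type:
-- adjacency is a symmetric, irreflexive, proof-irrelevant relation.
record Graph : Set₁ where
  field
    V      : Set
    _~_    : V → V → Set
    ~-sym  : ∀ {u v} → u ~ v → v ~ u
    ~-irr  : ∀ {v} → ¬ (v ~ v)
    ~-prop : ∀ {u v} (p q : u ~ v) → p ≡ q

module _ (G : Graph) where
  open Graph G

  Cubic : Set
  Cubic = ∀ v → Σ V (λ w → v ~ w) ↔ Fin 3

  record Ray : Set where
    field
      at  : ℕ → V
      inj : ∀ m n → at m ≡ at n → m ≡ n
      adj : ∀ n → at n ~ at (suc n)
  open Ray public

  data Walk : V → V → Set where
    []  : ∀ {v} → Walk v v
    _∷_ : ∀ {u v w} → u ~ v → Walk v w → Walk u w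

  verts : ∀ {u w} → Walk u w → List V
  verts {u} []       = u ∷ []
  verts {u} (_ ∷ W)  = u ∷ verts W

  Separates : List V → Ray → Ray → Set
  Separates S R₁ R₂ =
    ∀ m n (W : Walk (at R₁ m) (at R₂ n)) → Any (λ x → x ∈ S) (verts W)

  EndEquiv : Ray → Ray → Set
  EndEquiv R₁ R₂ = ∀ (S : List V) → ¬ Separates S R₁ R₂

  SameEdge : V → V → V → V → Set
  SameEdge a b c d = (a ≡ c × b ≡ d) ⊎ (a ≡ d × b ≡ c)

  VertexDisjoint : Ray → Ray → Set
  VertexDisjoint R₁ R₂ = ∀ m n → at R₁ m ≢ at R₂ n

  EdgeDisjoint : Ray → Ray → Set
  EdgeDisjoint R₁ R₂ =
    ∀ m n → ¬ SameEdge (at R₁ m) (at R₁ (suc m)) (at R₂ n) (at R₂ (suc n))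

  -- the end ω is represented by a ray ω; R belongs to ω iff EndEquiv R ω.
  -- ω contains k pairwise edge-disjoint rays
  HasEdgeDisjointRays : Ray → ℕ → Set
  HasEdgeDisjointRays ω k =
    Σ (Fin k → Ray) λ R →
      (∀ i → EndEquiv (R i) ω) × (∀ i j → i ≢ j → EdgeDisjoint (R i) (R j))

  HasVertexDisjointRays : Ray → ℕ → Set
  HasVertexDisjointRays ω k =
    Σ (Fin k → Ray) λ R →
      (∀ i → EndEquiv (R i) ω) × (∀ i j → i ≢ j → VertexDisjoint (R i) (R j))

-- If two edge-disjoint rays R and S met at an inner vertex x = R(m+1) = S(n+1),
-- then R(m), R(m+2), S(n), S(n+2) would be four distinct neighbours of x,
-- which a cubic graph does not have.  Hence edge-disjoint rays become
-- vertex-disjoint once their first vertices are deleted, and deleting a first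
-- vertex does not change the end of a ray.
module Submission where

open import Defs
open import Data.Nat using (ℕ; zero; suc; _≤_)
open import Data.Nat.Properties using (suc-injective; 1+n≰n)
open import Data.Fin using (Fin)
open import Data.Fin.Properties using (injective⇒≤)
open import Data.Empty using (⊥)
open import Data.Product using (_,_; proj₁)
open import Data.Sum using (inj₁; inj₂)
open import Data.List using (_∷_)
open import Data.List.Relation.Unary.Any using (Any; here; there)
import Data.List.Relation.Unary.Any as Any
open import Data.Vec using (Vec; []; _∷_)
open import Data.Vec.Relation.Unary.All using ([]; _∷_)
open import Data.Vec.Relation.Unary.Unique.Propositional using (Unique; []; _∷_)
open import Data.Vec.Relation.Unary.Unique.Propositional.Properties using (lookup-injective)
open import Relation.Binary.PropositionalEquality using (_≢_; refl; sym; cong; subst)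
open import Function using (_∘_)
open import Function.Bundles using (_↔_; _⇔_; mk⇔; Injection)
open import Function.Properties.Inverse using (↔⇒↣)

unique-length≤size : ∀ {a} {A : Set a} {d n} → A ↔ Fin d →
  {xs : Vec A n} → Unique xs → n ≤ d
unique-length≤size A↔Fin unique =
  injective⇒≤ (lookup-injective unique _ _ ∘ Injection.injective (↔⇒↣ A↔Fin))

module _ (G : Graph) where
  open Graph G

  tail : Ray G → Ray G
  tail R = record
    { at  = at R ∘ suc
    ; inj = λ m n eq → suc-injective (inj R (suc m) (suc n) eq)
    ; adj = adj R ∘ suc
    }

  verts-start : ∀ {u w} {P : V → Set} (W : Walk G u w) → P u → Any P (verts G W)
  verts-start []      Pu = here Pu
  verts-start (_ ∷ _) Pu = here Pu

  Separates-tail : ∀ S R ω → Separates G S (tail R) ω →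
    Separates G (at R 0 ∷ S) R ω
  Separates-tail S R ω sep zero    n W = verts-start W (here refl)
  Separates-tail S R ω sep (suc m) n W = Any.map there (sep m n W)

  EndEquiv-tail : ∀ R ω → EndEquiv G R ω → EndEquiv G (tail R) ω
  EndEquiv-tail R ω R~ω S = R~ω (at R 0 ∷ S) ∘ Separates-tail S R ω

  VertexDisjoint⇒EdgeDisjoint : ∀ R S → VertexDisjoint G R S → EdgeDisjoint G R S
  VertexDisjoint⇒EdgeDisjoint R S disj m n (inj₁ (eq , _)) = disj m n eq
  VertexDisjoint⇒EdgeDisjoint R S disj m n (inj₂ (eq , _)) = disj m (suc n) eq

  cubic⇒¬four-distinct-neighbours : Cubic G → ∀ {x a b c d} →
    x ~ a → x ~ b → x ~ c → x ~ d →
    a ≢ b → a ≢ c → a ≢ d → b ≢ c → b ≢ d → c ≢ d → ⊥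
  cubic⇒¬four-distinct-neighbours cubic {x} xa xb xc xd ab ac ad bc bd cd =
    1+n≰n (unique-length≤size (cubic x) unique)
    where
    apart : ∀ {u v} {p : x ~ u} {q : x ~ v} → u ≢ v → (u , p) ≢ (v , q)
    apart u≢v = u≢v ∘ cong proj₁

    unique : Unique ((_ , xa) ∷ (_ , xb) ∷ (_ , xc) ∷ (_ , xd) ∷ [])
    unique = (apart ab ∷ apart ac ∷ apart ad ∷ [])
           ∷ (apart bc ∷ apart bd ∷ [])
           ∷ (apart cd ∷ [])
           ∷ []
           ∷ []

  EdgeDisjoint⇒VertexDisjoint-tail : Cubic G → ∀ R S →
    EdgeDisjoint G R S → VertexDisjoint G (tail R) (tail S)
  EdgeDisjoint⇒VertexDisjoint-tail cubic R S disj m n eq =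
    cubic⇒¬four-distinct-neighbours cubic
      (~-sym (adj R m)) (adj R (suc m))
      (subst (_~ at S n) (sym eq) (~-sym (adj S n)))
      (subst (_~ at S (suc (suc n))) (sym eq) (adj S (suc n)))
      (n≢2+n ∘ inj R m (suc (suc m)))
      (λ e → disj m n (inj₁ (e , eq)))
      (λ e → disj m (suc n) (inj₂ (e , eq)))
      (λ e → disj (suc m) n (inj₂ (eq , e)))
      (λ e → disj (suc m) (suc n) (inj₁ (eq , e)))
      (n≢2+n ∘ inj S n (suc (suc n)))
    where
    n≢2+n : ∀ {k} → k ≢ suc (suc k)
    n≢2+n ()

  HasVertexDisjointRays⇒HasEdgeDisjointRays : ∀ {ω k} →
    HasVertexDisjointRays G ω k → HasEdgeDisjointRays G ω k
  HasVertexDisjointRays⇒HasEdgeDisjointRays (R , R~ω , disj) =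
    R , R~ω , λ i j i≢j → VertexDisjoint⇒EdgeDisjoint (R i) (R j) (disj i j i≢j)

  HasEdgeDisjointRays⇒HasVertexDisjointRays : Cubic G → ∀ {ω k} →
    HasEdgeDisjointRays G ω k → HasVertexDisjointRays G ω k
  HasEdgeDisjointRays⇒HasVertexDisjointRays cubic {ω} (R , R~ω , disj) =
    tail ∘ R , (λ i → EndEquiv-tail (R i) ω (R~ω i)) ,
    λ i j i≢j → EdgeDisjoint⇒VertexDisjoint-tail cubic (R i) (R j) (disj i j i≢j)

lemma2p2 : (G : Graph) → Cubic G → (ω : Ray G) → (k : ℕ) →
    HasEdgeDisjointRays G ω k ⇔ HasVertexDisjointRays G ω k
lemma2p2 G cubic ω k = mk⇔
  (HasEdgeDisjointRays⇒HasVertexDisjointRays G cubic {ω} {k})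
  (HasVertexDisjointRays⇒HasEdgeDisjointRays G {ω} {k})
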